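{- Let $\Lambda$ be the set of $\lambda$-terms of the untyped lambda calculus, ${\rm NF}_{\Lambda}$ the set of $\lambda$-terms in $\beta$-normal form, and $I_{\Lambda}=(\Lambda,{\rm NF}_{\Lambda}\cup\{\bot\},V_\beta)$ the interpreted language where $V_\beta(M)$ is the $\beta$-normal form of $M$ if it exists and $\bot$ otherwise. Let $\ulcorner\cdot\urcorner:\Lambda\to{\rm NF}_{\Lambda}$ be Mogensen's representation schema and $E_{\Lambda}:{\rm NF}_{\Lambda}\to\Lambda$ the partial function defined by $E_{\Lambda}(M)=E\,M$ if $M=\ulcorner N\urcorner$ for some $N\in\Lambda$ and undefined otherwise, where $E$ is Mogensen's self-interpreter. Then \[F_{\Lambda}=({\rm NF}_{\Lambda},\ulcorner\cdot\urcorner,{\rm NF}_{\Lambda},\ulcorner\cdot\urcorner,E_{\Lambda})\] is a syntax framework for $(\Lambda,I_{\Lambda})$.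
   Context: $\lambda$-terms are given by $\Lambda ::= x \mid \Lambda\,\Lambda \mid \lambda x.\Lambda$ over a countable set of variables; a normal form is a term to which $\beta$-reduction cannot be applied; normal forms are identified up to $\alpha$-conversion. Mogensen's representation schema: $\ulcorner x\urcorner=\lambda abc.\,a\,x$, $\ulcorner M\,N\urcorner=\lambda abc.\,b\,\ulcorner M\urcorner\,\ulcorner N\urcorner$, $\ulcorner \lambda x.M\urcorner=\lambda abc.\,c\,(\lambda x.\ulcorner M\urcorner)$, where $a,b,c$ are variables not free in $M,N$. Mogensen's self-interpreter is the term $E=Y\,\lambda e.\lambda m.\,m\,(\lambda x.x)\,(\lambda m n.(e\,m)(e\,n))\,(\lambda m.\lambda v.e(m\,v))$ with $Y$ the Y-combinator; it satisfies $E\,\ulcorner M\urcorner=_\beta M$ for all $M\in\Lambda$. Definitions: an interpreted language is a triple $I=(L,D_{\rm sem},V_{\rm sem})$ with $L$ a set of expressions, $D_{\rm sem}$ a nonempty set and $V_{\rm sem}:L\to D_{\rm sem}$ total. For $L_{\rm obj}\subseteq L$, a syntax framework for $(L_{\rm obj},I)$ is a tuple $F=(D_{\rm syn},V_{\rm syn},L_{\rm syn},Q,E')$ such that: (1) $D_{\rm syn}$ is a nonempty set of values representing syntactic structures and $V_{\rm syn}:L_{\rm obj}\to D_{\rm syn}$ is injective and total, assigning each expression a value representing its syntactic structure; (2) $L_{\rm syn}\subseteq L$, $D_{\rm syn}\subseteq D_{\rm sem}$, and $V_{\rm sem}$ restricted to $L_{\rm syn}$ is a total function into $D_{\rm syn}$;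 (3) $Q:L_{\rm obj}\to L_{\rm syn}$ is injective and total with $V_{\rm sem}(Q(e))=V_{\rm syn}(e)$ for all $e\in L_{\rm obj}$ (Quotation Axiom); (4) $E':L_{\rm syn}\to L_{\rm obj}$ is a possibly partial function with $V_{\rm sem}(E'(e))=V_{\rm sem}(V_{\rm syn}^{ -1}(V_{\rm sem}(e)))$ whenever $E'(e)$ is defined (Evaluation Axiom). -}

module Defs where

open import Data.Nat using (ℕ; zero; suc; _+_)
open import Data.Maybe using (Maybe; just; nothing)
open import Data.Product using (Σ; _×_; _,_; proj₁; ∃)
open import Data.Unit using (⊤)
open import Relation.Nullary using (¬_)
open import Relation.Unary using (Pred)
open import Relation.Binary.PropositionalEquality using (_≡_)
open import Relation.Binary.Construct.Closure.ReflexiveTransitive using (Star)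
open import Level using (0ℓ)

record InterpretedLanguage : Set₁ where
  field
    L        : Set
    Dsem     : Set
    Vsem     : L → Dsem
    Dsem-inh : Dsem

-- Subsets are predicates; a possibly partial function A ⇀ B is a
-- single-valued relation.
record IsSyntaxFramework (I : InterpretedLanguage)
    (Lobj : Pred (InterpretedLanguage.L I) 0ℓ)
    (Dsyn : Pred (InterpretedLanguage.Dsem I) 0ℓ)
    (Vsyn : (e : InterpretedLanguage.L I) → Lobj e → InterpretedLanguage.Dsem I)
    (Lsyn : Pred (InterpretedLanguage.L I) 0ℓ)
    (Q    : (e : InterpretedLanguage.L I) → Lobj e → InterpretedLanguage.L I)
    (E'   : InterpretedLanguage.L I → InterpretedLanguage.L I → Set)
    : Set where
  open InterpretedLanguage I
  field
    Dsyn-nonempty : Σ Dsem Dsyn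
    Vsyn-into     : ∀ e (p : Lobj e) → Dsyn (Vsyn e p)
    Vsyn-injective : ∀ e e' (p : Lobj e) (p' : Lobj e') → Vsyn e p ≡ Vsyn e' p' → e ≡ e'
    -- (2)  (Lsyn ⊆ L and Dsyn ⊆ Dsem hold by construction)
    Vsem-Lsyn     : ∀ e → Lsyn e → Dsyn (Vsem e)
    Q-into        : ∀ e (p : Lobj e) → Lsyn (Q e p)
    Q-injective   : ∀ e e' (p : Lobj e) (p' : Lobj e') → Q e p ≡ Q e' p' → e ≡ e'
    quotation     : ∀ e (p : Lobj e) → Vsem (Q e p) ≡ Vsyn e p
    E'-dom        : ∀ e r → E' e r → Lsyn e
    E'-cod        : ∀ e r → E' e r → Lobj r
    E'-functional : ∀ e r r' → E' e r → E' e r' → r ≡ r'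
    evaluation    : ∀ e r → E' e r →
                    Σ (InterpretedLanguage.L I) λ e'' → Σ (Lobj e'') λ p'' →
                      (Vsyn e'' p'' ≡ Vsem e) × (Vsem r ≡ Vsem e'')

-- Untyped λ-calculus, de Bruijn indices (terms up to α-conversion)

data Term : Set where
  var : ℕ → Term
  app : Term → Term → Term
  lam : Term → Term

shiftVar : ℕ → ℕ → ℕ → ℕ
shiftVar zero    d i       = i + d
shiftVar (suc c) d zero    = zero
shiftVar (suc c) d (suc i) = suc (shiftVar c d i)

shift : ℕ → ℕ → Term → Term
shift c d (var i)   = var (shiftVar c d i)
shift c d (app M N) = app (shift c d M) (shift c d N)
shift c d (lam M)   = lam (shift (suc c) d M)

substVar : ℕ → ℕ → Term → Term
substVar zero    zero    N = N
substVar zero    (suc i) N = var i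
substVar (suc k) zero    N = var zero
substVar (suc k) (suc i) N = shift 0 1 (substVar k i N)

subst : ℕ → Term → Term → Term
subst k N (var i)   = substVar k i N
subst k N (app M P) = app (subst k N M) (subst k N P)
subst k N (lam M)   = lam (subst (suc k) N M)

infix 4 _⟶β_ _⟶β*_
data _⟶β_ : Term → Term → Set where
  β    : ∀ {M N} → app (lam M) N ⟶β subst 0 N M
  appL : ∀ {M M' N} → M ⟶β M' → app M N ⟶β app M' N
  appR : ∀ {M N N'} → N ⟶β N' → app M N ⟶β app M N'
  ξ    : ∀ {M M'} → M ⟶β M' → lam M ⟶β lam M'

_⟶β*_ : Term → Term → Set
_⟶β*_ = Star _⟶β_

-- normal form: a term to which β-reduction cannot be applied
-- (irrelevant field so that the NF type has term-determined equality)
record IsNF (M : Term) : Set where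
  constructor isNF
  field
    .noRed : ∀ N → ¬ (M ⟶β N)

NF : Set
NF = Σ Term IsNF

-- Specification of V_β : Λ → NF ∪ {⊥} (⊥ rendered as nothing)
IsVβ : (Term → Maybe NF) → Set
IsVβ V = ∀ M →
  (∀ (n : NF) → V M ≡ just n → M ⟶β* proj₁ n) ×
  (V M ≡ nothing → ¬ Σ NF (λ n → M ⟶β* proj₁ n)) ×
  (¬ Σ NF (λ n → M ⟶β* proj₁ n) → V M ≡ nothing)

ILam : (Term → Maybe NF) → InterpretedLanguage
ILam V = record { L = Term ; Dsem = Maybe NF ; Vsem = V ; Dsem-inh = nothing }

DsynLam : Pred (Maybe NF) 0ℓ
DsynLam d = Σ NF λ n → d ≡ just n

lam3 : Term → Term
lam3 M = lam (lam (lam M))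

-- ⌜x⌝ = λabc. a x ;  ⌜M N⌝ = λabc. b ⌜M⌝ ⌜N⌝ ;  ⌜λx.M⌝ = λabc. c (λx.⌜M⌝)
quoteT : Term → Term
quoteT (var i)   = lam3 (app (var 2) (var (i + 3)))
quoteT (app M N) = lam3 (app (app (var 1) (shift 0 3 (quoteT M))) (shift 0 3 (quoteT N)))
quoteT (lam M)   = lam3 (app (var 0) (lam (shift 1 3 (quoteT M))))

Ycomb : Term
Ycomb = lam (app (lam (app (var 1) (app (var 0) (var 0))))
                 (lam (app (var 1) (app (var 0) (var 0)))))

-- E = Y λe.λm. m (λx.x) (λm n.(e m)(e n)) (λm.λv. e (m v))
Ecomb : Term
Ecomb = app Ycomb (lam (lam
  (app (app (app (var 0) (lam (var 0)))
            (lam (lam (app (app (var 3) (var 1)) (app (var 3) (var 0))))))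
       (lam (lam (app (var 3) (app (var 1) (var 0))))))))

ELam : Term → Term → Set
ELam M R = Σ Term λ N → (M ≡ quoteT N) × (R ≡ app Ecomb M)

-- Every application inside ⌜M⌝ has a variable in head position, so ⌜M⌝ is
-- β-normal, and the schema is injective because the bound variable used in
-- ⌜M⌝ (a, b or c) records the outermost constructor of M.  Applied to ⌜M⌝, E
-- unfolds once and passes its three case handlers to ⌜M⌝, which selects the
-- handler for its constructor; by induction on M this gives E ⌜M⌝ ⟶β* M.
-- By the Church–Rosser theorem (via Takahashi's complete developments) V_β is
-- invariant under β-reduction, so V_β (E ⌜M⌝) = V_β M: the Evaluation Axiom.
module Submission where

open import Defs
open import Data.Maybe using (Maybe; just; nothing)
open import Data.Maybe.Properties using (just-injective)
open import Data.Product using (Σ; _,_; proj₁; proj₂; _×_)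
open import Data.Unit using (⊤; tt)
open import Data.Empty using (⊥; ⊥-elim; ⊥-elim-irr)
open import Data.Nat using (ℕ; zero; suc; _+_; _≤_; z≤n; s≤s)
open import Data.Nat.Properties using (+-comm; +-suc; +-identityʳ; +-cancelʳ-≡; ≤-trans; m≤n+m; ≤-refl; suc-injective)
open import Relation.Binary.PropositionalEquality using (_≡_; refl; sym; trans; cong; cong₂; _≗_)
open import Relation.Binary.Construct.Closure.ReflexiveTransitive using (Star; ε; _◅_; _◅◅_; gmap; map; concat)
open import Relation.Binary.Rewriting using (Confluent)

appL* : ∀ {M M' N} → M ⟶β* M' → app M N ⟶β* app M' N
appL* {N = N} = gmap (λ M → app M N) appL

appR* : ∀ {M N N'} → N ⟶β* N' → app M N ⟶β* app M N'
appR* {M = M} = gmap (app M) appR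

lam* : ∀ {M M'} → M ⟶β* M' → lam M ⟶β* lam M'
lam* = gmap lam ξ

⟶β-cast : ∀ {M N N'} → M ⟶β N → N ≡ N' → M ⟶β N'
⟶β-cast s refl = s

Ren : Set
Ren = ℕ → ℕ

Sub : Set
Sub = ℕ → Term

ext : Ren → Ren
ext ρ zero    = zero
ext ρ (suc i) = suc (ρ i)

ren : Ren → Term → Term
ren ρ (var i)   = var (ρ i)
ren ρ (app M N) = app (ren ρ M) (ren ρ N)
ren ρ (lam M)   = lam (ren (ext ρ) M)

exts : Sub → Sub
exts σ zero    = var zero
exts σ (suc i) = ren suc (σ i)

sub : Sub → Term → Term
sub σ (var i)   = σ i
sub σ (app M N) = app (sub σ M) (sub σ N)
sub σ (lam M)   = lam (sub (exts σ) M)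

single : Term → Sub
single N zero    = N
single N (suc i) = var i

ext-cong : ∀ {ρ ρ'} → ρ ≗ ρ' → ext ρ ≗ ext ρ'
ext-cong h zero    = refl
ext-cong h (suc i) = cong suc (h i)

ren-cong : ∀ {ρ ρ'} → ρ ≗ ρ' → ∀ M → ren ρ M ≡ ren ρ' M
ren-cong h (var i)   = cong var (h i)
ren-cong h (app M N) = cong₂ app (ren-cong h M) (ren-cong h N)
ren-cong h (lam M)   = cong lam (ren-cong (ext-cong h) M)

exts-cong : ∀ {σ σ'} → σ ≗ σ' → exts σ ≗ exts σ'
exts-cong h zero    = refl
exts-cong h (suc i) = cong (ren suc) (h i)

sub-cong : ∀ {σ σ'} → σ ≗ σ' → ∀ M → sub σ M ≡ sub σ' M
sub-cong h (var i)   = h i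
sub-cong h (app M N) = cong₂ app (sub-cong h M) (sub-cong h N)
sub-cong h (lam M)   = cong lam (sub-cong (exts-cong h) M)

ren-ren : ∀ ρ ρ' M → ren ρ (ren ρ' M) ≡ ren (λ i → ρ (ρ' i)) M
ren-ren ρ ρ' (var i)   = refl
ren-ren ρ ρ' (app M N) = cong₂ app (ren-ren ρ ρ' M) (ren-ren ρ ρ' N)
ren-ren ρ ρ' (lam M)   = cong lam (trans (ren-ren (ext ρ) (ext ρ') M)
  (ren-cong (λ { zero → refl ; (suc i) → refl }) M))

ren-sub : ∀ ρ σ M → ren ρ (sub σ M) ≡ sub (λ i → ren ρ (σ i)) M
ren-sub ρ σ (var i)   = refl
ren-sub ρ σ (app M N) = cong₂ app (ren-sub ρ σ M) (ren-sub ρ σ N)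
ren-sub ρ σ (lam M)   = cong lam (trans (ren-sub (ext ρ) (exts σ) M)
  (sub-cong (λ { zero → refl
               ; (suc i) → trans (ren-ren (ext ρ) suc (σ i)) (sym (ren-ren suc ρ (σ i))) }) M))

sub-ren : ∀ σ ρ M → sub σ (ren ρ M) ≡ sub (λ i → σ (ρ i)) M
sub-ren σ ρ (var i)   = refl
sub-ren σ ρ (app M N) = cong₂ app (sub-ren σ ρ M) (sub-ren σ ρ N)
sub-ren σ ρ (lam M)   = cong lam (trans (sub-ren (exts σ) (ext ρ) M)
  (sub-cong (λ { zero → refl ; (suc i) → refl }) M))

sub-sub : ∀ σ τ M → sub σ (sub τ M) ≡ sub (λ i → sub σ (τ i)) M
sub-sub σ τ (var i)   = refl
sub-sub σ τ (app M N) = cong₂ app (sub-sub σ τ M) (sub-sub σ τ N)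
sub-sub σ τ (lam M)   = cong lam (trans (sub-sub (exts σ) (exts τ) M)
  (sub-cong (λ { zero → refl
               ; (suc i) → trans (sub-ren (exts σ) suc (τ i)) (sym (ren-sub suc σ (τ i))) }) M))

sub-var : ∀ M → sub var M ≡ M
sub-var (var i)   = refl
sub-var (app M N) = cong₂ app (sub-var M) (sub-var N)
sub-var (lam M)   = cong lam (trans (sub-cong (λ { zero → refl ; (suc i) → refl }) M) (sub-var M))

+1≡suc : ∀ i → i + 1 ≡ suc i
+1≡suc i = +-comm i 1

shift-as-ren : ∀ c d M → shift c d M ≡ ren (shiftVar c d) M
shift-as-ren c d (var i)   = refl
shift-as-ren c d (app M N) = cong₂ app (shift-as-ren c d M) (shift-as-ren c d N)
shift-as-ren c d (lam M)   = cong lam (trans (shift-as-ren (suc c) d M)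
  (ren-cong (λ { zero → refl ; (suc i) → refl }) M))

subst-as-sub : ∀ k N M → subst k N M ≡ sub (λ i → substVar k i N) M
subst-as-sub k N (var i)   = refl
subst-as-sub k N (app M P) = cong₂ app (subst-as-sub k N M) (subst-as-sub k N P)
subst-as-sub k N (lam M)   = cong lam (trans (subst-as-sub (suc k) N M)
  (sub-cong (λ { zero → refl
               ; (suc i) → trans (shift-as-ren 0 1 (substVar k i N)) (ren-cong +1≡suc (substVar k i N)) }) M))

subst0-as-sub : ∀ N M → subst 0 N M ≡ sub (single N) M
subst0-as-sub N M = trans (subst-as-sub 0 N M) (sub-cong (λ { zero → refl ; (suc i) → refl }) M)

ren-subst0 : ∀ ρ N M → ren ρ (subst 0 N M) ≡ subst 0 (ren ρ N) (ren (ext ρ) M)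
ren-subst0 ρ N M = trans (cong (ren ρ) (subst0-as-sub N M)) (trans (ren-sub ρ (single N) M)
  (sym (trans (subst0-as-sub (ren ρ N) (ren (ext ρ) M)) (trans (sub-ren (single (ren ρ N)) (ext ρ) M)
     (sub-cong (λ { zero → refl ; (suc i) → refl }) M)))))

sub-subst0 : ∀ σ N M → sub σ (subst 0 N M) ≡ subst 0 (sub σ N) (sub (exts σ) M)
sub-subst0 σ N M = trans (cong (sub σ) (subst0-as-sub N M)) (trans (sub-sub σ (single N) M)
  (sym (trans (subst0-as-sub (sub σ N) (sub (exts σ) M)) (trans (sub-sub (single (sub σ N)) (exts σ) M)
     (sub-cong (λ { zero → refl
                  ; (suc i) → trans (sub-ren (single (sub σ N)) suc (σ i)) (sub-var (σ i)) }) M)))))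

infix 4 _⇉_
data _⇉_ : Term → Term → Set where
  pvar : ∀ {i} → var i ⇉ var i
  plam : ∀ {M M'} → M ⇉ M' → lam M ⇉ lam M'
  papp : ∀ {M M' N N'} → M ⇉ M' → N ⇉ N' → app M N ⇉ app M' N'
  pβ   : ∀ {M M' N N'} → M ⇉ M' → N ⇉ N' → app (lam M) N ⇉ subst 0 N' M'

⇉-cast : ∀ {M M₁ N₁ N} → M ≡ M₁ → M₁ ⇉ N₁ → N₁ ≡ N → M ⇉ N
⇉-cast refl p refl = p

⇉-refl : ∀ M → M ⇉ M
⇉-refl (var i)   = pvar
⇉-refl (app M N) = papp (⇉-refl M) (⇉-refl N)
⇉-refl (lam M)   = plam (⇉-refl M)

⇉-ren : ∀ ρ {M M'} → M ⇉ M' → ren ρ M ⇉ ren ρ M'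
⇉-ren ρ pvar       = pvar
⇉-ren ρ (plam p)   = plam (⇉-ren (ext ρ) p)
⇉-ren ρ (papp p q) = papp (⇉-ren ρ p) (⇉-ren ρ q)
⇉-ren ρ (pβ {M' = M'} {N' = N'} p q) =
  ⇉-cast refl (pβ (⇉-ren (ext ρ) p) (⇉-ren ρ q)) (sym (ren-subst0 ρ N' M'))

⇉-exts : ∀ {σ τ} → (∀ i → σ i ⇉ τ i) → ∀ i → exts σ i ⇉ exts τ i
⇉-exts h zero    = pvar
⇉-exts h (suc i) = ⇉-ren suc (h i)

⇉-sub : ∀ {σ τ} → (∀ i → σ i ⇉ τ i) → ∀ {M M'} → M ⇉ M' → sub σ M ⇉ sub τ M'
⇉-sub h (pvar {i})  = h i
⇉-sub h (plam p)    = plam (⇉-sub (⇉-exts h) p)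
⇉-sub h (papp p q)  = papp (⇉-sub h p) (⇉-sub h q)
⇉-sub {τ = τ} h (pβ {M' = M'} {N' = N'} p q) =
  ⇉-cast refl (pβ (⇉-sub (⇉-exts h) p) (⇉-sub h q)) (sym (sub-subst0 τ N' M'))

⇉-subst0 : ∀ {M M' N N'} → M ⇉ M' → N ⇉ N' → subst 0 N M ⇉ subst 0 N' M'
⇉-subst0 {M} {M'} {N} {N'} p q =
  ⇉-cast (subst0-as-sub N M) (⇉-sub (λ { zero → q ; (suc i) → pvar }) p) (sym (subst0-as-sub N' M'))

_⁺ : Term → Term
var i ⁺           = var i
lam M ⁺           = lam (M ⁺)
app (lam M) N ⁺   = subst 0 (N ⁺) (M ⁺)
app (var i) N ⁺   = app (var i) (N ⁺)
app (app M M') N ⁺ = app (app M M' ⁺) (N ⁺)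

⇉-⁺ : ∀ {M N} → M ⇉ N → N ⇉ M ⁺
⇉-⁺ pvar                  = pvar
⇉-⁺ (plam p)              = plam (⇉-⁺ p)
⇉-⁺ (pβ p q)              = ⇉-subst0 (⇉-⁺ p) (⇉-⁺ q)
⇉-⁺ (papp pvar q)         = papp pvar (⇉-⁺ q)
⇉-⁺ (papp (plam p) q)     = pβ (⇉-⁺ p) (⇉-⁺ q)
⇉-⁺ (papp (papp p p') q)  = papp (⇉-⁺ (papp p p')) (⇉-⁺ q)
⇉-⁺ (papp (pβ p p') q)    = papp (⇉-⁺ (pβ p p')) (⇉-⁺ q)

⟶β⇒⇉ : ∀ {M N} → M ⟶β N → M ⇉ N
⟶β⇒⇉ (β {M} {N})        = pβ (⇉-refl M) (⇉-refl N)
⟶β⇒⇉ (appL {N = N} s)   = papp (⟶β⇒⇉ s) (⇉-refl N)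
⟶β⇒⇉ (appR {M = M} s)   = papp (⇉-refl M) (⟶β⇒⇉ s)
⟶β⇒⇉ (ξ s)              = plam (⟶β⇒⇉ s)

⇉⇒⟶β* : ∀ {M N} → M ⇉ N → M ⟶β* N
⇉⇒⟶β* pvar       = ε
⇉⇒⟶β* (plam p)   = lam* (⇉⇒⟶β* p)
⇉⇒⟶β* (papp p q) = appL* (⇉⇒⟶β* p) ◅◅ appR* (⇉⇒⟶β* q)
⇉⇒⟶β* (pβ p q)   = appL* (lam* (⇉⇒⟶β* p)) ◅◅ appR* (⇉⇒⟶β* q) ◅◅ β ◅ ε

⇉-strip : ∀ {M A B} → M ⇉ A → Star _⇉_ M B → Σ Term λ C → (Star _⇉_ A C) × (B ⇉ C)
⇉-strip {A = A} p ε = A , ε , p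
⇉-strip p (q ◅ r) with ⇉-strip (⇉-⁺ q) r
... | C , s , t = C , ⇉-⁺ p ◅ s , t

⇉-confluent : Confluent _⇉_
⇉-confluent {C = C} ε r = C , r , ε
⇉-confluent (p ◅ r) r' with ⇉-strip p r'
... | D , s , t with ⇉-confluent r s
...   | E , u , v = E , u , t ◅ v

⟶β-confluent : Confluent _⟶β_
⟶β-confluent r r' with ⇉-confluent (map ⟶β⇒⇉ r) (map ⟶β⇒⇉ r')
... | C , u , v = C , concat (map ⇉⇒⟶β* u) , concat (map ⇉⇒⟶β* v)

IsNF-⟶β*-≡ : ∀ {M N} → IsNF M → M ⟶β* N → M ≡ N
IsNF-⟶β*-≡ _        ε       = refl
IsNF-⟶β*-≡ (isNF f) (s ◅ r) = ⊥-elim-irr (f _ s)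

nf-unique : ∀ {M t t'} → IsNF t → IsNF t' → M ⟶β* t → M ⟶β* t' → t ≡ t'
nf-unique p p' r r' with ⟶β-confluent r r'
... | C , u , v = trans (IsNF-⟶β*-≡ p u) (sym (IsNF-⟶β*-≡ p' v))

nf-of-reduct : ∀ {M M' t} → IsNF t → M ⟶β* M' → M ⟶β* t → M' ⟶β* t
nf-of-reduct p r r' with ⟶β-confluent r r'
... | C , u , v rewrite IsNF-⟶β*-≡ p v = u

NF-≡ : ∀ {t t'} (p : IsNF t) (p' : IsNF t') → t ≡ t' → _≡_ {A = NF} (t , p) (t' , p')
NF-≡ p p' refl = refl

data Neutral : Term → Set
data Normal : Term → Set

data Neutral where
  nvar : ∀ {i} → Neutral (var i)
  napp : ∀ {M N} → Neutral M → Normal N → Neutral (app M N)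

data Normal where
  nne  : ∀ {M} → Neutral M → Normal M
  nlam : ∀ {M} → Normal M → Normal (lam M)

Neutral-shift : ∀ c d {M} → Neutral M → Neutral (shift c d M)
Normal-shift  : ∀ c d {M} → Normal M → Normal (shift c d M)
Neutral-shift c d nvar       = nvar
Neutral-shift c d (napp n m) = napp (Neutral-shift c d n) (Normal-shift c d m)
Normal-shift c d (nne n)     = nne (Neutral-shift c d n)
Normal-shift c d (nlam m)    = nlam (Normal-shift (suc c) d m)

Neutral-irreducible : ∀ {M N} → Neutral M → M ⟶β N → ⊥
Normal-irreducible  : ∀ {M N} → Normal M → M ⟶β N → ⊥
Neutral-irreducible (napp () _) β
Neutral-irreducible (napp n m) (appL s) = Neutral-irreducible n s
Neutral-irreducible (napp n m) (appR s) = Normal-irreducible m s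
Normal-irreducible (nne n) s            = Neutral-irreducible n s
Normal-irreducible (nlam m) (ξ s)       = Normal-irreducible m s

quoteT-Normal : ∀ M → Normal (quoteT M)
quoteT-Normal (var i)   = nlam (nlam (nlam (nne (napp nvar (nne nvar)))))
quoteT-Normal (app M N) = nlam (nlam (nlam (nne (napp (napp nvar (Normal-shift 0 3 (quoteT-Normal M)))
                                                         (Normal-shift 0 3 (quoteT-Normal N))))))
quoteT-Normal (lam M)   = nlam (nlam (nlam (nne (napp nvar (nlam (Normal-shift 1 3 (quoteT-Normal M)))))))

quoteT-IsNF : ∀ M → IsNF (quoteT M)
quoteT-IsNF M = isNF (λ _ → Normal-irreducible (quoteT-Normal M))

var-injective : ∀ {i j} → var i ≡ var j → i ≡ j
var-injective refl = refl

app-injective : ∀ {M M' N N'} → app M N ≡ app M' N' → M ≡ M' × N ≡ N'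
app-injective refl = refl , refl

lam-injective : ∀ {M N} → lam M ≡ lam N → M ≡ N
lam-injective refl = refl

lam3-injective : ∀ {M N} → lam3 M ≡ lam3 N → M ≡ N
lam3-injective refl = refl

shiftVar-injective : ∀ c d {i j} → shiftVar c d i ≡ shiftVar c d j → i ≡ j
shiftVar-injective zero    d {i} {j} eq        = +-cancelʳ-≡ d i j eq
shiftVar-injective (suc c) d {zero}  {zero}  eq = refl
shiftVar-injective (suc c) d {suc i} {suc j} eq = cong suc (shiftVar-injective c d (suc-injective eq))

shift-injective : ∀ c d {M N} → shift c d M ≡ shift c d N → M ≡ N
shift-injective c d {var i}   {var j}   eq = cong var (shiftVar-injective c d (var-injective eq))
shift-injective c d {app M M'} {app N N'} eq with app-injective eq
... | eq₁ , eq₂ = cong₂ app (shift-injective c d eq₁) (shift-injective c d eq₂)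
shift-injective c d {lam M}   {lam N}   eq = cong lam (shift-injective (suc c) d (lam-injective eq))

quoteT-injective : ∀ {M N} → quoteT M ≡ quoteT N → M ≡ N
quoteT-injective {var i} {var j} eq =
  cong var (+-cancelʳ-≡ 3 i j (var-injective (proj₂ (app-injective (lam3-injective eq)))))
quoteT-injective {app M M'} {app N N'} eq with app-injective (lam3-injective eq)
... | eq₁ , eq₂ = cong₂ app (quoteT-injective (shift-injective 0 3 (proj₂ (app-injective eq₁))))
                            (quoteT-injective (shift-injective 0 3 eq₂))
quoteT-injective {lam M} {lam N} eq =
  cong lam (quoteT-injective (shift-injective 1 3 (lam-injective (proj₂ (app-injective (lam3-injective eq))))))

shift-zero : ∀ c M → shift c 0 M ≡ M
shift-zero c (var i)   = cong var (shiftVar-zero c i)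
  where
  shiftVar-zero : ∀ c i → shiftVar c 0 i ≡ i
  shiftVar-zero zero    i       = +-identityʳ i
  shiftVar-zero (suc c) zero    = refl
  shiftVar-zero (suc c) (suc i) = cong suc (shiftVar-zero c i)
shift-zero c (app M N) = cong₂ app (shift-zero c M) (shift-zero c N)
shift-zero c (lam M)   = cong lam (shift-zero (suc c) M)

substVar-beyond : ∀ j m P → j ≤ m → substVar j (suc m) P ≡ var m
substVar-beyond zero    m       P _          = refl
substVar-beyond (suc j) (suc m) P (s≤s j≤m) =
  trans (cong (shift 0 1) (substVar-beyond j m P j≤m)) (cong var (+1≡suc m))

substVar-shiftVar : ∀ c j d P i → j ≤ d → substVar (c + j) (shiftVar c (suc d) i) P ≡ var (shiftVar c d i)
substVar-shiftVar zero    j d P i       j≤d = trans (cong (λ k → substVar j k P) (+-suc i d))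
  (substVar-beyond j (i + d) P (≤-trans j≤d (m≤n+m d i)))
substVar-shiftVar (suc c) j d P zero    j≤d = refl
substVar-shiftVar (suc c) j d P (suc i) j≤d =
  trans (cong (shift 0 1) (substVar-shiftVar c j d P i j≤d)) (cong var (+1≡suc _))

subst-shift : ∀ c j d P M → j ≤ d → subst (c + j) P (shift c (suc d) M) ≡ shift c d M
subst-shift c j d P (var i)   j≤d = substVar-shiftVar c j d P i j≤d
subst-shift c j d P (app M N) j≤d = cong₂ app (subst-shift c j d P M j≤d) (subst-shift c j d P N j≤d)
subst-shift c j d P (lam M)   j≤d = cong lam (subst-shift (suc c) j d P M j≤d)

subst-shift-cancel : ∀ c P M → subst (c + 0) P (shift c 1 M) ≡ M
subst-shift-cancel c P M = trans (subst-shift c 0 0 P M z≤n) (shift-zero c M)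

subst-var0-shift : ∀ k M → subst k (var 0) (shift (suc k) 1 M) ≡ M
subst-var0-shift k (var i)   = substVar-var0 k i
  where
  substVar-var0 : ∀ k i → substVar k (shiftVar (suc k) 1 i) (var 0) ≡ var i
  substVar-var0 zero    zero    = refl
  substVar-var0 zero    (suc i) = cong var (+1≡suc i)
  substVar-var0 (suc k) zero    = refl
  substVar-var0 (suc k) (suc i) = trans (cong (shift 0 1) (substVar-var0 k i)) (cong var (+1≡suc i))
subst-var0-shift k (app M N) = cong₂ app (subst-var0-shift k M) (subst-var0-shift k N)
subst-var0-shift k (lam M)   = cong lam (subst-var0-shift (suc k) M)

Efun : Term
Efun = lam (lam
  (app (app (app (var 0) (lam (var 0)))
            (lam (lam (app (app (var 3) (var 1)) (app (var 3) (var 0))))))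
       (lam (lam (app (var 3) (app (var 1) (var 0)))))))

Eself : Term
Eself = lam (app Efun (app (var 0) (var 0)))

-- One β-step turns Ecomb = Y Efun into Efix, which satisfies Efix ⟶β Efun Efix.
Efix : Term
Efix = app Eself Eself

idCase : Term
idCase = lam (var 0)

appCase : Term
appCase = lam (lam (app (app Efix (var 1)) (app Efix (var 0))))

lamCase : Term
lamCase = lam (lam (app Efix (app (var 1) (var 0))))

Efix-unfold : ∀ Q → app Efix Q ⟶β* app (app (app Q idCase) appCase) lamCase
Efix-unfold Q = appL β ◅ appL β ◅ β ◅ ε

substVar-idCase : ∀ i → substVar 2 (i + 3) idCase ≡ var (suc (suc i))
substVar-idCase i = trans (cong (λ k → substVar 2 k idCase) (+-comm i 3))
  (cong var (trans (+1≡suc (i + 1)) (cong suc (+1≡suc i))))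

Efix-quoteT : ∀ N → app Efix (quoteT N) ⟶β* N
quoteT-cases : ∀ N → app (app (app (quoteT N) idCase) appCase) lamCase ⟶β* N

Efix-quoteT N = Efix-unfold (quoteT N) ◅◅ quoteT-cases N

quoteT-cases (var i) =
  ⟶β-cast (appL (appL β)) (cong (λ t → app (app (lam (lam (app idCase t))) appCase) lamCase) (substVar-idCase i)) ◅
  ⟶β-cast (appL β) (cong (λ t → app (lam (app idCase (var t))) lamCase) (+1≡suc i)) ◅
  β ◅ β ◅ ε
quoteT-cases (app M N) =
  ⟶β-cast (appL (appL β)) (cong₂ (λ a b → app (app (lam (lam (app (app (var 1) a) b))) appCase) lamCase)
     (subst-shift 0 2 2 idCase ⌜M⌝ ≤-refl) (subst-shift 0 2 2 idCase ⌜N⌝ ≤-refl)) ◅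
  ⟶β-cast (appL β) (cong₂ (λ a b → app (lam (app (app appCase a) b)) lamCase)
     (subst-shift 0 1 1 appCase ⌜M⌝ ≤-refl) (subst-shift 0 1 1 appCase ⌜N⌝ ≤-refl)) ◅
  ⟶β-cast β (cong₂ (λ a b → app (app appCase a) b)
     (subst-shift-cancel 0 lamCase ⌜M⌝) (subst-shift-cancel 0 lamCase ⌜N⌝)) ◅
  appL β ◅
  ⟶β-cast β (cong (λ a → app (app Efix a) (app Efix ⌜N⌝)) (subst-shift-cancel 0 ⌜N⌝ ⌜M⌝)) ◅
  appL* (Efix-quoteT M) ◅◅ appR* (Efix-quoteT N)
  where
  ⌜M⌝ = quoteT M
  ⌜N⌝ = quoteT N
quoteT-cases (lam M) =
  ⟶β-cast (appL (appL β)) (cong (λ a → app (app (lam (lam (app (var 0) (lam a)))) appCase) lamCase)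
     (subst-shift 1 2 2 idCase ⌜M⌝ ≤-refl)) ◅
  ⟶β-cast (appL β) (cong (λ a → app (lam (app (var 0) (lam a))) lamCase) (subst-shift 1 1 1 appCase ⌜M⌝ ≤-refl)) ◅
  ⟶β-cast β (cong (λ a → app lamCase (lam a)) (subst-shift-cancel 1 lamCase ⌜M⌝)) ◅
  β ◅
  ⟶β-cast (ξ (appR β)) (cong (λ a → lam (app Efix a)) (subst-var0-shift 0 ⌜M⌝)) ◅
  lam* (Efix-quoteT M)
  where
  ⌜M⌝ = quoteT M

Ecomb-quoteT : ∀ N → app Ecomb (quoteT N) ⟶β* N
Ecomb-quoteT N = appL β ◅ Efix-quoteT N

module _ (Vβ : Term → Maybe NF) (spec : IsVβ Vβ) where

  Vβ-reduct-nf : ∀ M (n : NF) → M ⟶β* proj₁ n → Vβ M ≡ just n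
  Vβ-reduct-nf M (t , p) r with Vβ M in eq
  ... | just (t' , p') = cong just (NF-≡ p' p (nf-unique p' p (proj₁ (spec M) (t' , p') eq) r))
  ... | nothing        = ⊥-elim (proj₁ (proj₂ (spec M)) eq ((t , p) , r))

  Vβ-IsNF : ∀ {M} (p : IsNF M) → Vβ M ≡ just (M , p)
  Vβ-IsNF {M} p = Vβ-reduct-nf M (M , p) ε

  Vβ-⟶β*-invariant : ∀ {M M'} → M ⟶β* M' → Vβ M ≡ Vβ M'
  Vβ-⟶β*-invariant {M} {M'} r with Vβ M' in eq
  ... | just n  = Vβ-reduct-nf M n (r ◅◅ proj₁ (spec M') n eq)
  ... | nothing = proj₂ (proj₂ (spec M)) λ { ((t , p) , r') →
                    proj₁ (proj₂ (spec M')) eq ((t , p) , nf-of-reduct p r r') }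

mainTheorem4 : (Vβ : Term → Maybe NF) → IsVβ Vβ →
    Σ (∀ M → IsNF (quoteT M)) λ qn →
    IsSyntaxFramework (ILam Vβ) (λ _ → ⊤) DsynLam (λ M _ → just (quoteT M , qn M)) IsNF (λ M _ → quoteT M) ELam
mainTheorem4 Vβ spec = quoteT-IsNF , record
  { Dsyn-nonempty  = just ⌜ var 0 ⌝ , ⌜ var 0 ⌝ , refl
  ; Vsyn-into      = λ M _ → ⌜ M ⌝ , refl
  ; Vsyn-injective = λ _ _ _ _ eq → quoteT-injective (cong proj₁ (just-injective eq))
  ; Vsem-Lsyn      = λ M p → (M , p) , Vβ-IsNF Vβ spec p
  ; Q-into         = λ M _ → quoteT-IsNF M
  ; Q-injective    = λ _ _ _ _ → quoteT-injective
  ; quotation      = λ M _ → Vβ-IsNF Vβ spec (quoteT-IsNF M)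
  ; E'-dom         = λ { _ _ (N , refl , _) → quoteT-IsNF N }
  ; E'-cod         = λ _ _ _ → tt
  ; E'-functional  = λ { _ _ _ (_ , _ , refl) (_ , _ , refl) → refl }
  ; evaluation     = λ { _ _ (N , refl , refl) →
      N , tt , sym (Vβ-IsNF Vβ spec (quoteT-IsNF N)) , Vβ-⟶β*-invariant Vβ spec (Ecomb-quoteT N) }
  }
  where
  ⌜_⌝ : Term → NF
  ⌜ M ⌝ = quoteT M , quoteT-IsNF M
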